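{- Let $G$ be a graph such that $C_4+G$ has no isolated vertices, and let $H=C_4+G+N_k$ (for some $k\ge 0$) be a sum graph with sum labelling $\lambda$. Then for every edge $xy$ of the $C_4$, every vertex $z$ of $H$ with $\lambda(z)=\lambda(x)+\lambda(y)$ is not a vertex of the $C_4$.
   Context: A graph $H=(V,E)$ is a sum graph with sum labelling $\lambda$ if $\lambda:V\to\mathbb{N}$ is injective and $E=\{xy : \exists z\in V,\ \lambda(z)=\lambda(x)+\lambda(y)\}$. $N_k$ denotes $k$ isolated vertices and $+$ denotes disjoint union; $C_4$ is the 4-cycle. -}

module Defs where

open import Data.Nat using (ℕ; _+_)
open import Data.Fin using (Fin; zero; suc)
open import Data.Sum using (_⊎_; inj₁; inj₂)
open import Data.Product using (∃; _×_)
open import Data.Empty using (⊥)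
open import Relation.Nullary using (¬_)
open import Relation.Binary.PropositionalEquality using (_≡_)
open import Function.Definitions using (Injective)
open import Function.Bundles using (_⇔_)
open import Level using (0ℓ)

record Graph (n : ℕ) : Set₁ where
  field
    Adj     : Fin n → Fin n → Set
    sym     : ∀ {x y} → Adj x y → Adj y x
    irrefl  : ∀ {x} → ¬ Adj x x
open Graph public

NoIsolated : ∀ {n} → Graph n → Set
NoIsolated {n} G = (v : Fin n) → ∃ λ w → Adj G v w

next : Fin 4 → Fin 4
next zero = suc zero
next (suc zero) = suc (suc zero)
next (suc (suc zero)) = suc (suc (suc zero))
next (suc (suc (suc zero))) = zero

C4Adj : Fin 4 → Fin 4 → Set
C4Adj i j = (j ≡ next i) ⊎ (i ≡ next j)

HVert : ℕ → ℕ → Set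
HVert m k = Fin 4 ⊎ (Fin m ⊎ Fin k)

HAdj : ∀ {m} → Graph m → (k : ℕ) → HVert m k → HVert m k → Set
HAdj G k (inj₁ i) (inj₁ j) = C4Adj i j
HAdj G k (inj₂ (inj₁ a)) (inj₂ (inj₁ b)) = Adj G a b
HAdj G k _ _ = ⊥

IsSumLabelling : (V : Set) → (V → V → Set) → (V → ℕ) → Set
IsSumLabelling V Adj' lab =
  Injective _≡_ _≡_ lab ×
  ((x y : V) → ¬ (x ≡ y) → Adj' x y ⇔ (∃ λ z → lab z ≡ lab x + lab y))

{-# OPTIONS --safe #-}
module Submission where

-- Labels are positive, since every vertex has a non-neighbour.  Take an edge
-- ab of the C₄ and suppose some C₄ vertex c carries λa + λb.  As λa, λb > 0,
-- c is neither a nor b, so with d the fourth vertex the cycle is a–b–c–d–a.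
-- Let r carry λd + λa (from the edge da) and s carry λc + λd (from cd); then
-- λs = λb + λr, so r = b or r is a neighbour of b; but r = a forces λd = 0
-- and r = c forces λb = λd.  Hence λb = λd + λa: the same situation one step
-- around the cycle.  Doing it twice gives λa = λc + λd, and then λb + λd = 0.

open import Defs hiding (sym)
open import Data.Nat using (ℕ; _+_)
open import Data.Nat.Properties using (_≟_; +-comm; +-assoc; +-identityʳ; +-cancelˡ-≡; m+n≡0⇒n≡0)
open import Data.Fin using (Fin; zero; suc)
open import Data.Sum using (_⊎_; inj₁; inj₂; swap)
import Data.Sum as Sum
open import Data.Sum.Properties using (inj₁-injective)
open import Data.Product using (∃; _×_; _,_; proj₁; proj₂)
open import Data.Empty using (⊥-elim)
open import Relation.Nullary using (¬_; yes; no)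
open import Relation.Binary.PropositionalEquality
  using (_≡_; _≢_; refl; sym; trans; cong; module ≡-Reasoning)
open import Function.Base using (_∘_)
open import Function.Bundles using (Equivalence)

m≡m+n⇒n≡0 : ∀ m {n} → m ≡ m + n → n ≡ 0
m≡m+n⇒n≡0 m {n} eq = sym (+-cancelˡ-≡ m 0 n (trans (+-identityʳ m) eq))

n≡m+n⇒m≡0 : ∀ m {n} → n ≡ m + n → m ≡ 0
n≡m+n⇒m≡0 m {n} eq = m≡m+n⇒n≡0 n (trans eq (+-comm m n))

module SumLabelling {V : Set} {E : V → V → Set} {lab : V → ℕ}
                    (E-irrefl : ∀ {x} → ¬ E x x)
                    (sl : IsSumLabelling V E lab) where

  lab-injective : ∀ {x y} → lab x ≡ lab y → x ≡ y
  lab-injective = proj₁ sl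

  sum⇒adj : ∀ {x y} z → x ≢ y → lab z ≡ lab x + lab y → E x y
  sum⇒adj z x≢y z≡x+y = Equivalence.from (proj₂ sl _ _ x≢y) (z , z≡x+y)

  adj⇒sum : ∀ {x y} → E x y → ∃ λ z → lab z ≡ lab x + lab y
  adj⇒sum xy = Equivalence.to (proj₂ sl _ _ λ { refl → E-irrefl xy }) xy

  zero-label⇒adj : ∀ {v w} → lab v ≡ 0 → v ≢ w → E v w
  zero-label⇒adj {w = w} v≡0 v≢w = sum⇒adj w v≢w (cong (_+ lab w) (sym v≡0))

  lab≢0 : (∀ v → ∃ λ w → v ≢ w × ¬ E v w) → ∀ v → lab v ≢ 0
  lab≢0 non-neighbour v v≡0 =
    let w , v≢w , ¬vw = non-neighbour v in ¬vw (zero-label⇒adj v≡0 v≢w)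

  module _ (lab-positive : ∀ v → lab v ≢ 0) where

    square-sum-rotate : ∀ {a b c d} → E c d → E d a → b ≢ d →
                        (∀ {t} → E b t → t ≡ a ⊎ t ≡ c) →
                        lab c ≡ lab a + lab b → lab b ≡ lab d + lab a
    square-sum-rotate {a} {b} {c} {d} cd da b≢d nbrs-b c≡a+b
      with adj⇒sum da | adj⇒sum cd
    ... | r , r≡d+a | s , s≡c+d with lab r ≟ lab b
    ...   | yes r≡b = trans (sym r≡b) r≡d+a
    ...   | no r≢b with nbrs-b (sum⇒adj s (λ { refl → r≢b refl }) s≡b+r)
      where
      open ≡-Reasoning
      s≡b+r : lab s ≡ lab b + lab r
      s≡b+r = begin
        lab s                    ≡⟨ s≡c+d ⟩
        lab c + lab d            ≡⟨ cong (_+ lab d) c≡a+b ⟩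
        lab a + lab b + lab d    ≡⟨ cong (_+ lab d) (+-comm (lab a) (lab b)) ⟩
        lab b + lab a + lab d    ≡⟨ +-assoc (lab b) (lab a) (lab d) ⟩
        lab b + (lab a + lab d)  ≡⟨ cong (lab b +_) (+-comm (lab a) (lab d)) ⟩
        lab b + (lab d + lab a)  ≡⟨ cong (lab b +_) (sym r≡d+a) ⟩
        lab b + lab r            ∎
    ...     | inj₁ refl = ⊥-elim (lab-positive d (n≡m+n⇒m≡0 (lab d) r≡d+a))
    ...     | inj₂ refl = ⊥-elim (b≢d (lab-injective (+-cancelˡ-≡ (lab a) _ _
                            (trans (sym c≡a+b) (trans r≡d+a (+-comm (lab d) (lab a)))))))

    square-no-sum : ∀ {a b c d} → E b c → E c d → E d a → b ≢ d → a ≢ c →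
                    (∀ {t} → E a t → t ≡ d ⊎ t ≡ b) →
                    (∀ {t} → E b t → t ≡ a ⊎ t ≡ c) →
                    lab c ≢ lab a + lab b
    square-no-sum {a} {b} {c} {d} bc cd da b≢d a≢c nbrs-a nbrs-b c≡a+b =
      lab-positive b (m+n≡0⇒n≡0 (lab d) (m≡m+n⇒n≡0 (lab c) c≡c+[d+b]))
      where
      b≡d+a : lab b ≡ lab d + lab a
      b≡d+a = square-sum-rotate cd da b≢d nbrs-b c≡a+b
      a≡c+d : lab a ≡ lab c + lab d
      a≡c+d = square-sum-rotate bc cd a≢c nbrs-a b≡d+a
      c≡c+[d+b] : lab c ≡ lab c + (lab d + lab b)
      c≡c+[d+b] = trans c≡a+b (trans (cong (_+ lab b) a≡c+d) (+-assoc (lab c) (lab d) (lab b)))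

prev : Fin 4 → Fin 4
prev i = next (next (next i))

prev-next : ∀ i → prev (next i) ≡ i
prev-next zero                   = refl
prev-next (suc zero)             = refl
prev-next (suc (suc zero))       = refl
prev-next (suc (suc (suc zero))) = refl

next-prev : ∀ i → next (prev i) ≡ i
next-prev i = prev-next i

≢next² : ∀ i → i ≢ next (next i)
≢next² zero                   ()
≢next² (suc zero)             ()
≢next² (suc (suc zero))       ()
≢next² (suc (suc (suc zero))) ()

C4Adj-sym : ∀ {i j} → C4Adj i j → C4Adj j i
C4Adj-sym = swap

C4Adj-next : ∀ i → C4Adj i (next i)
C4Adj-next i = inj₁ refl

C4Adj-prev : ∀ i → C4Adj i (prev i)
C4Adj-prev i = inj₂ (sym (next-prev i))

C4Adj-irrefl : ∀ {i} → ¬ C4Adj i i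
C4Adj-irrefl {zero}                 (inj₁ ())
C4Adj-irrefl {zero}                 (inj₂ ())
C4Adj-irrefl {suc zero}             (inj₁ ())
C4Adj-irrefl {suc zero}             (inj₂ ())
C4Adj-irrefl {suc (suc zero)}       (inj₁ ())
C4Adj-irrefl {suc (suc zero)}       (inj₂ ())
C4Adj-irrefl {suc (suc (suc zero))} (inj₁ ())
C4Adj-irrefl {suc (suc (suc zero))} (inj₂ ())

¬C4Adj-next² : ∀ i → ¬ C4Adj i (next (next i))
¬C4Adj-next² zero                   (inj₁ ())
¬C4Adj-next² zero                   (inj₂ ())
¬C4Adj-next² (suc zero)             (inj₁ ())
¬C4Adj-next² (suc zero)             (inj₂ ())
¬C4Adj-next² (suc (suc zero))       (inj₁ ())
¬C4Adj-next² (suc (suc zero))       (inj₂ ())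
¬C4Adj-next² (suc (suc (suc zero))) (inj₁ ())
¬C4Adj-next² (suc (suc (suc zero))) (inj₂ ())

C4Adj⇒prev⊎next : ∀ {i j} → C4Adj i j → j ≡ prev i ⊎ j ≡ next i
C4Adj⇒prev⊎next         (inj₁ j≡next-i) = inj₂ j≡next-i
C4Adj⇒prev⊎next {j = j} (inj₂ refl)     = inj₁ (sym (prev-next j))

C4-vertices : ∀ i c → c ≡ i ⊎ c ≡ next i ⊎ c ≡ next (next i) ⊎ c ≡ prev i
C4-vertices zero                   zero                   = inj₁ refl
C4-vertices zero                   (suc zero)             = inj₂ (inj₁ refl)
C4-vertices zero                   (suc (suc zero))       = inj₂ (inj₂ (inj₁ refl))
C4-vertices zero                   (suc (suc (suc zero))) = inj₂ (inj₂ (inj₂ refl))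
C4-vertices (suc zero)             zero                   = inj₂ (inj₂ (inj₂ refl))
C4-vertices (suc zero)             (suc zero)             = inj₁ refl
C4-vertices (suc zero)             (suc (suc zero))       = inj₂ (inj₁ refl)
C4-vertices (suc zero)             (suc (suc (suc zero))) = inj₂ (inj₂ (inj₁ refl))
C4-vertices (suc (suc zero))       zero                   = inj₂ (inj₂ (inj₁ refl))
C4-vertices (suc (suc zero))       (suc zero)             = inj₂ (inj₂ (inj₂ refl))
C4-vertices (suc (suc zero))       (suc (suc zero))       = inj₁ refl
C4-vertices (suc (suc zero))       (suc (suc (suc zero))) = inj₂ (inj₁ refl)
C4-vertices (suc (suc (suc zero))) zero                   = inj₂ (inj₁ refl)
C4-vertices (suc (suc (suc zero))) (suc zero)             = inj₂ (inj₂ (inj₁ refl))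
C4-vertices (suc (suc (suc zero))) (suc (suc zero))       = inj₂ (inj₂ (inj₂ refl))
C4-vertices (suc (suc (suc zero))) (suc (suc (suc zero))) = inj₁ refl

module _ {m} (G : Graph m) (k : ℕ) where

  private
    C4 : Fin 4 → HVert m k
    C4 = inj₁

  C4-≢next² : ∀ i → C4 i ≢ C4 (next (next i))
  C4-≢next² i eq = ≢next² i (inj₁-injective eq)

  HAdj-irrefl : ∀ {x} → ¬ HAdj G k x x
  HAdj-irrefl {inj₁ _}        = C4Adj-irrefl
  HAdj-irrefl {inj₂ (inj₁ _)} = irrefl G
  HAdj-irrefl {inj₂ (inj₂ _)} ()

  HAdj-non-neighbour : ∀ x → ∃ λ w → x ≢ w × ¬ HAdj G k x w
  HAdj-non-neighbour (inj₁ i) = C4 (next (next i)) , C4-≢next² i , ¬C4Adj-next² i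
  HAdj-non-neighbour (inj₂ (inj₁ _)) = C4 zero , (λ ()) , (λ ())
  HAdj-non-neighbour (inj₂ (inj₂ _)) = C4 zero , (λ ()) , (λ ())

  HAdj-C4⇒prev⊎next : ∀ {i t} → HAdj G k (C4 i) t → t ≡ C4 (prev i) ⊎ t ≡ C4 (next i)
  HAdj-C4⇒prev⊎next {t = inj₁ _} it = Sum.map (cong inj₁) (cong inj₁) (C4Adj⇒prev⊎next it)

  HAdj-C4-next⇒ : ∀ {i t} → HAdj G k (C4 (next i)) t → t ≡ C4 i ⊎ t ≡ C4 (next (next i))
  HAdj-C4-next⇒ {i} it = Sum.map₁ (λ t≡prev → trans t≡prev (cong inj₁ (prev-next i))) (HAdj-C4⇒prev⊎next it)

  module _ {lab : HVert m k → ℕ} (sl : IsSumLabelling (HVert m k) (HAdj G k) lab) where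

    open SumLabelling (λ {x} → HAdj-irrefl {x}) sl

    positive : ∀ v → lab v ≢ 0
    positive = lab≢0 HAdj-non-neighbour

    C4-no-edge-sum : ∀ i c → lab (C4 c) ≢ lab (C4 i) + lab (C4 (next i))
    C4-no-edge-sum i c with C4-vertices i c
    ... | inj₁ refl               = positive (C4 (next i)) ∘ m≡m+n⇒n≡0 (lab (C4 i))
    ... | inj₂ (inj₁ refl)        = positive (C4 i) ∘ n≡m+n⇒m≡0 (lab (C4 i))
    ... | inj₂ (inj₂ (inj₁ refl)) =
      square-no-sum positive
        (C4Adj-next (next i)) (C4Adj-next (next (next i))) (C4Adj-sym (C4Adj-prev i))
        (C4-≢next² (next i)) (C4-≢next² i)
        HAdj-C4⇒prev⊎next HAdj-C4-next⇒
    ... | inj₂ (inj₂ (inj₂ refl)) = λ eq →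
      square-no-sum positive
        (C4Adj-prev i) (C4Adj-sym (C4Adj-next (next (next i)))) (C4Adj-sym (C4Adj-next (next i)))
        (C4-≢next² i) (C4-≢next² (next i))
        (swap ∘ HAdj-C4-next⇒) (swap ∘ HAdj-C4⇒prev⊎next)
        (trans eq (+-comm (lab (C4 i)) (lab (C4 (next i)))))

lemma16 : (m : ℕ) (G : Graph m) → NoIsolated G →
          (k : ℕ) (lab : HVert m k → ℕ) →
          IsSumLabelling (HVert m k) (HAdj G k) lab →
          (i j : Fin 4) → C4Adj i j →
          (z : HVert m k) → lab z ≡ lab (inj₁ i) + lab (inj₁ j) →
          ¬ (∃ λ c → z ≡ inj₁ c)
lemma16 m G _ k lab sl i j ij (inj₂ _) _ (_ , ())
lemma16 m G _ k lab sl i j (inj₁ refl) (inj₁ c) c≡i+j _ = C4-no-edge-sum G k sl i c c≡i+j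
lemma16 m G _ k lab sl i j (inj₂ refl) (inj₁ c) c≡i+j _ =
  C4-no-edge-sum G k sl j c (trans c≡i+j (+-comm (lab (inj₁ i)) (lab (inj₁ j))))
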